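{- Let $\mathcal{T}$ be a finite derivation of $\mathrm{labCS}^\infty$ (a finite tree of sequents built from rule instances, possibly with open leaves). Any saturation phase applied to $\mathcal{T}$ terminates after finitely many rule applications and yields a finite tree whose open leaves are saturated.
   Context: Formulas: $A::=\bot\mid p\mid A\to A\mid\Box A\mid\triangle A$ over a countable set $\mathtt{Prop}$ of atoms. Fix a countable set of labels. A labelled formula is $x:A$; a relational atom is $xRy$ or $xSy$. A sequent $\mathcal{R},\Gamma\Rightarrow\Omega$ consists of a finite multiset $\mathcal{R}$ of relational atoms and finite multisets $\Gamma,\Omega$ of labelled formulas. Relevant rules of $\mathrm{labCS}^\infty$ (premisses / conclusion): ($\to$R) from $\mathcal{R},\Gamma,x:A\Rightarrow x:B,\Omega$ infer $\mathcal{R},\Gamma\Rightarrow x:A\to B,\Omega$; ($\to$L) from $\mathcal{R},\Gamma\Rightarrow x:A,\Omega$ and $\mathcal{R},\Gamma,x:B\Rightarrow\Omega$ infer $\mathcal{R},\Gamma,x:A\to B\Rightarrow\Omega$; ($\Box$L) from $\mathcal{R},xRy,x:\Box A,y:A,\Gamma\Rightarrow\Omega$ infer $\mathcal{R},xRy,x:\Box A,\Gamma\Rightarrow\Omega$; ($\triangle$L) from $\mathcal{R},xSy,x:\triangle A,y:A,\Gamma\Rightarrow\Omega$ infer $\mathcal{R},xSy,x:\triangle A,\Gamma\Rightarrow\Omega$; ($\mathrm{trans}_{\circ\bullet}$, $\circ,\bullet\in\{R,S\}$) from $\mathcal{R},x\circ y,y\bullet z,x\bullet z,\Gamma\Rightarrow\Omega$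 infer $\mathcal{R},x\circ y,y\bullet z,\Gamma\Rightarrow\Omega$. (The remaining rules are Id, $\bot$ with no premisses, and $\Box$R, $\triangle$R which introduce a fresh label.) A derivation is a tree of sequents each of whose nodes with its children is a rule instance, except that some leaves (open leaves) need not be conclusions of premiss-free rules. A labelled formula $x:A$ occurring in $\mathcal{R},\Gamma\Rightarrow\Omega$ is saturated if: $A\in\mathtt{Prop}$ or $A=\bot$; or $A=A_1\to A_2$, and if $x:A\in\Gamma$ then $x:A_1\in\Omega$ or $x:A_2\in\Gamma$, and if $x:A\in\Omega$ then $x:A_1\in\Gamma$ and $x:A_2\in\Omega$; or $A=\Box A_1$, and if $x:A\in\Gamma$ then $y:A_1\in\Gamma$ for all $y$ with $xRy\in\mathcal{R}$; or $A=\triangle A_1$, and if $x:A\in\Gamma$ then $y:A_1\in\Gamma$ for all $y$ with $xSy\in\mathcal{R}$. A sequent is saturated if all its labelled formulas are saturated and $\mathcal{R}$ is closed under transitivity (whenever $x\circ y,y\bullet z\in\mathcal{R}$ with $\circ,\bullet\in\{R,S\}$, also $x\bullet z\in\mathcal{R}$). A saturation phase over a derivation consists of applying (bottom-up) the rules $\to$L, $\to$R, $\Box$L, $\triangle$L and $\mathrm{trans}_{\circ\bullet}$ to open leaves that are not saturated, each application resolving a failure of saturation (i.e. not merely adding formulas or relational atoms already present), in any order, as long as possible. -}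

module Defs where

open import Data.Nat using (ℕ)
open import Data.Unit using (⊤)
open import Data.List using (List; []; _∷_; map)
open import Data.List.Membership.Propositional using (_∈_; _∉_)
open import Data.List.Relation.Unary.All using (All)
open import Data.List.Relation.Unary.Any using (Any; _─_)
open import Data.Product using (_×_; _,_)
open import Data.Sum using (_⊎_)
open import Relation.Nullary using (¬_)

infixr 6 _⇒_
data Fm : Set where
  ⊥ᶠ  : Fm
  at  : ℕ → Fm
  _⇒_ : Fm → Fm → Fm
  □_  : Fm → Fm
  △_  : Fm → Fm

Label : Set
Label = ℕ

data RK : Set where
  R S : RK

record RAtom : Set where
  constructor ⟨_,_,_⟩
  field
    src  : Label
    kind : RK
    tgt  : Label

LFm : Set
LFm = Label × Fm

-- Sequents  ℛ , Γ ⇒ Ω  (finite multisets represented by lists; every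
-- notion below depends only on membership / removal of one occurrence,
-- hence is invariant under reordering)
record Seq : Set where
  constructor _∣_⊢_
  field
    rel : List RAtom
    ant : List LFm
    suc : List LFm
open Seq public

SatAnt : Seq → LFm → Set
SatAnt σ (x , ⊥ᶠ)    = ⊤
SatAnt σ (x , at p)  = ⊤
SatAnt σ (x , A ⇒ B) = (x , A) ∈ suc σ ⊎ (x , B) ∈ ant σ
SatAnt σ (x , □ A)   = ∀ y → ⟨ x , R , y ⟩ ∈ rel σ → (y , A) ∈ ant σ
SatAnt σ (x , △ A)   = ∀ y → ⟨ x , S , y ⟩ ∈ rel σ → (y , A) ∈ ant σ

SatSuc : Seq → LFm → Set
SatSuc σ (x , A ⇒ B) = (x , A) ∈ ant σ × (x , B) ∈ suc σ
SatSuc σ (x , _)     = ⊤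

TransClosed : Seq → Set
TransClosed σ = ∀ x y z (k k′ : RK) →
  ⟨ x , k , y ⟩ ∈ rel σ → ⟨ y , k′ , z ⟩ ∈ rel σ → ⟨ x , k′ , z ⟩ ∈ rel σ

Saturated : Seq → Set
Saturated σ = All (SatAnt σ) (ant σ) × All (SatSuc σ) (suc σ) × TransClosed σ

-- The rules →L, →R, □L, △L,
-- trans are given explicitly; the remaining rules (Id, ⊥, □R, △R) are
-- supplied by the parameter Other.

data LabRule (Other : Seq → List Seq → Set) : Seq → List Seq → Set where
  impL  : ∀ {ℛ Γ Ω x A B} (p : (x , A ⇒ B) ∈ Γ) →
          LabRule Other (ℛ ∣ Γ ⊢ Ω)
            ((ℛ ∣ (Γ ─ p) ⊢ ((x , A) ∷ Ω)) ∷ (ℛ ∣ ((x , B) ∷ (Γ ─ p)) ⊢ Ω) ∷ [])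
  impR  : ∀ {ℛ Γ Ω x A B} (p : (x , A ⇒ B) ∈ Ω) →
          LabRule Other (ℛ ∣ Γ ⊢ Ω) ((ℛ ∣ ((x , A) ∷ Γ) ⊢ ((x , B) ∷ (Ω ─ p))) ∷ [])
  boxL  : ∀ {ℛ Γ Ω x y A} → ⟨ x , R , y ⟩ ∈ ℛ → (x , □ A) ∈ Γ →
          LabRule Other (ℛ ∣ Γ ⊢ Ω) ((ℛ ∣ ((y , A) ∷ Γ) ⊢ Ω) ∷ [])
  triL  : ∀ {ℛ Γ Ω x y A} → ⟨ x , S , y ⟩ ∈ ℛ → (x , △ A) ∈ Γ →
          LabRule Other (ℛ ∣ Γ ⊢ Ω) ((ℛ ∣ ((y , A) ∷ Γ) ⊢ Ω) ∷ [])
  trans : ∀ {ℛ Γ Ω x y z} (k k′ : RK) →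
          ⟨ x , k , y ⟩ ∈ ℛ → ⟨ y , k′ , z ⟩ ∈ ℛ →
          LabRule Other (ℛ ∣ Γ ⊢ Ω) (((⟨ x , k′ , z ⟩ ∷ ℛ) ∣ Γ ⊢ Ω) ∷ [])
  other : ∀ {σ ps} → Other σ ps → LabRule Other σ ps

-- Applications of the saturation-phase rules that resolve a failure of
-- saturation of the (leaf) sequent they are applied to.
data PhaseRule : Seq → List Seq → Set where
  impL  : ∀ {ℛ Γ Ω x A B} (p : (x , A ⇒ B) ∈ Γ) →
          (x , A) ∉ Ω → (x , B) ∉ Γ →
          PhaseRule (ℛ ∣ Γ ⊢ Ω)
            ((ℛ ∣ (Γ ─ p) ⊢ ((x , A) ∷ Ω)) ∷ (ℛ ∣ ((x , B) ∷ (Γ ─ p)) ⊢ Ω) ∷ [])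
  impR  : ∀ {ℛ Γ Ω x A B} (p : (x , A ⇒ B) ∈ Ω) →
          ¬ ((x , A) ∈ Γ × (x , B) ∈ Ω) →
          PhaseRule (ℛ ∣ Γ ⊢ Ω) ((ℛ ∣ ((x , A) ∷ Γ) ⊢ ((x , B) ∷ (Ω ─ p))) ∷ [])
  boxL  : ∀ {ℛ Γ Ω x y A} → ⟨ x , R , y ⟩ ∈ ℛ → (x , □ A) ∈ Γ → (y , A) ∉ Γ →
          PhaseRule (ℛ ∣ Γ ⊢ Ω) ((ℛ ∣ ((y , A) ∷ Γ) ⊢ Ω) ∷ [])
  triL  : ∀ {ℛ Γ Ω x y A} → ⟨ x , S , y ⟩ ∈ ℛ → (x , △ A) ∈ Γ → (y , A) ∉ Γ →
          PhaseRule (ℛ ∣ Γ ⊢ Ω) ((ℛ ∣ ((y , A) ∷ Γ) ⊢ Ω) ∷ [])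
  trans : ∀ {ℛ Γ Ω x y z} (k k′ : RK) →
          ⟨ x , k , y ⟩ ∈ ℛ → ⟨ y , k′ , z ⟩ ∈ ℛ → ⟨ x , k′ , z ⟩ ∉ ℛ →
          PhaseRule (ℛ ∣ Γ ⊢ Ω) (((⟨ x , k′ , z ⟩ ∷ ℛ) ∣ Γ ⊢ Ω) ∷ [])

-- Finite trees of sequents with open leaves (inductive ⇒ finite)

data Tree : Set where
  leaf : Seq → Tree               -- open leaf
  node : Seq → List Tree → Tree

root : Tree → Seq
root (leaf σ)   = σ
root (node σ _) = σ

data IsDerivation (Other : Seq → List Seq → Set) : Tree → Set where
  leaf : ∀ σ → IsDerivation Other (leaf σ)
  node : ∀ σ ts → LabRule Other σ (map root ts) →
         All (IsDerivation Other) ts → IsDerivation Other (node σ ts)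

data OpenLeaf (σ : Seq) : Tree → Set where
  here  : OpenLeaf σ (leaf σ)
  below : ∀ {σ′ ts} → Any (OpenLeaf σ) ts → OpenLeaf σ (node σ′ ts)

infix 4 _⟶_ _⟶ₗ_ _⟵_
mutual
  data _⟶_ : Tree → Tree → Set where
    expand : ∀ {σ ps} → PhaseRule σ ps → leaf σ ⟶ node σ (map leaf ps)
    inside : ∀ {σ ts ts′} → ts ⟶ₗ ts′ → node σ ts ⟶ node σ ts′

  data _⟶ₗ_ : List Tree → List Tree → Set where
    hd : ∀ {t t′ ts} → t ⟶ t′ → t ∷ ts ⟶ₗ t′ ∷ ts
    tl : ∀ {t ts ts′} → ts ⟶ₗ ts′ → t ∷ ts ⟶ₗ t ∷ ts′

_⟵_ : Tree → Tree → Set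
T′ ⟵ T = T ⟶ T′

-- Applied to a leaf, every phase rule adds a labelled formula or relational atom that was
-- missing there, except that →L and →R also delete their principal x : A → B, adding x : A or
-- x : B on a side where it was missing. No fresh labels and no new formulas other than
-- subformulas arise, so everything stays inside the finite universe of labels × subformulas of
-- the original leaf. Weight x : C by the number of sides of the sequent it is missing from,
-- plus 3 times the weights of x : A and x : B when C = A → B: deleting the principal raises its
-- own count by at most 2, and the strictly lighter child pays for it three times over. So the
-- total weight plus the number of missing relational atoms drops from a leaf to each premiss,
-- and phases terminate. A leaf where no phase rule applies is saturated, since each failure of
-- saturation is exactly the side condition of a phase rule.
module Submission where

open import Defs
open import Data.Empty using () renaming (⊥ to Empty)
open import Data.List using (List; []; _∷_; map; _++_; concatMap; cartesianProduct; cartesianProductWith)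
open import Data.List.Membership.Propositional using (_∈_; _∉_)
open import Data.List.Membership.Propositional.Properties
  using (∈-++⁺ˡ; ∈-++⁺ʳ; ∈-++⁻; ∈-map⁺; ∈-concatMap⁺; ∈-concatMap⁻;
         ∈-cartesianProduct⁺; ∈-cartesianProduct⁻; ∈-cartesianProductWith⁺)
import Data.List.Membership.DecPropositional as DecMembership
open import Data.List.Relation.Binary.Subset.Propositional using (_⊆_)
open import Data.List.Relation.Binary.Subset.Propositional.Properties using (∈-∷⁺ʳ)
open import Data.List.Relation.Unary.All as All using (All; []; _∷_)
import Data.List.Relation.Unary.All.Properties as All
open import Data.List.Relation.Unary.Any as Any using (Any; here; there; _─_)
open import Data.Nat using (ℕ; _+_; _*_; _≤_; _<_; z≤n; s≤s)
open import Data.Nat.Induction using (<-wellFounded)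
open import Data.Nat.ListAction using (sum)
open import Data.Nat.Tactic.RingSolver using (solve-∀)
open import Data.Nat.Properties
  using (≤-refl; <⇒≤; +-mono-≤; +-mono-<-≤; +-mono-≤-<; +-monoˡ-<; +-monoʳ-<; *-monoʳ-≤; module ≤-Reasoning)
import Data.Nat.Properties as ℕ
open import Data.Product using (_×_; _,_; proj₁; proj₂; ∃; uncurry)
open import Data.Product.Properties using (≡-dec)
open import Data.Sum as Sum using (_⊎_; inj₁; inj₂; [_,_]′)
open import Data.Unit using (tt)
open import Function using (_∘_; id)
open import Induction.WellFounded using (Acc; acc)
open import Relation.Binary.Construct.Closure.ReflexiveTransitive using (Star)
open import Relation.Binary.Definitions using (DecidableEquality)
open import Relation.Binary.PropositionalEquality using (_≡_; _≢_; refl; cong)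
open import Relation.Nullary using (¬_; Dec; yes; no; contradiction)
open import Relation.Nullary.Decidable using (map′; _×-dec_)

_≟ᴷ_ : DecidableEquality RK
R ≟ᴷ R = yes refl
R ≟ᴷ S = no λ ()
S ≟ᴷ R = no λ ()
S ≟ᴷ S = yes refl

_≟ᶠ_ : DecidableEquality Fm
⊥ᶠ ≟ᶠ ⊥ᶠ = yes refl
at m ≟ᶠ at n = map′ (cong at) (λ { refl → refl }) (m ℕ.≟ n)
(A ⇒ B) ≟ᶠ (C ⇒ D) = map′ (λ { (refl , refl) → refl }) (λ { refl → refl , refl }) (A ≟ᶠ C ×-dec B ≟ᶠ D)
(□ A) ≟ᶠ (□ B) = map′ (cong □_) (λ { refl → refl }) (A ≟ᶠ B)
(△ A) ≟ᶠ (△ B) = map′ (cong △_) (λ { refl → refl }) (A ≟ᶠ B)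
⊥ᶠ ≟ᶠ at _ = no λ ()
⊥ᶠ ≟ᶠ (_ ⇒ _) = no λ ()
⊥ᶠ ≟ᶠ (□ _) = no λ ()
⊥ᶠ ≟ᶠ (△ _) = no λ ()
at _ ≟ᶠ ⊥ᶠ = no λ ()
at _ ≟ᶠ (_ ⇒ _) = no λ ()
at _ ≟ᶠ (□ _) = no λ ()
at _ ≟ᶠ (△ _) = no λ ()
(_ ⇒ _) ≟ᶠ ⊥ᶠ = no λ ()
(_ ⇒ _) ≟ᶠ at _ = no λ ()
(_ ⇒ _) ≟ᶠ (□ _) = no λ ()
(_ ⇒ _) ≟ᶠ (△ _) = no λ ()
(□ _) ≟ᶠ ⊥ᶠ = no λ ()
(□ _) ≟ᶠ at _ = no λ ()
(□ _) ≟ᶠ (_ ⇒ _) = no λ ()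
(□ _) ≟ᶠ (△ _) = no λ ()
(△ _) ≟ᶠ ⊥ᶠ = no λ ()
(△ _) ≟ᶠ at _ = no λ ()
(△ _) ≟ᶠ (_ ⇒ _) = no λ ()
(△ _) ≟ᶠ (□ _) = no λ ()

_≟ˡ_ : DecidableEquality LFm
_≟ˡ_ = ≡-dec ℕ._≟_ _≟ᶠ_

_≟ʳ_ : DecidableEquality RAtom
⟨ x , k , y ⟩ ≟ʳ ⟨ x′ , k′ , y′ ⟩ =
  map′ (λ { (refl , refl , refl) → refl }) (λ { refl → refl , refl , refl })
       (x ℕ.≟ x′ ×-dec k ≟ᴷ k′ ×-dec y ℕ.≟ y′)

open DecMembership _≟ˡ_ using () renaming (_∈?_ to _∈ˡ?_)
open DecMembership _≟ʳ_ using () renaming (_∈?_ to _∈ʳ?_)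

∈-─⁻ : ∀ {A : Set} {u v : A} {xs} (q : u ∈ xs) → v ∈ (xs ─ q) → v ∈ xs
∈-─⁻ (here _)  m         = there m
∈-─⁻ (there q) (here e)  = here e
∈-─⁻ (there q) (there m) = there (∈-─⁻ q m)

∈-─⁺ : ∀ {A : Set} {u v : A} {xs} (q : u ∈ xs) → v ∈ xs → v ≢ u → v ∈ (xs ─ q)
∈-─⁺ (here refl) (here refl) v≢u = contradiction refl v≢u
∈-─⁺ (here _)    (there m)   _   = m
∈-─⁺ (there q)   (here e)    _   = here e
∈-─⁺ (there q)   (there m)   v≢u = there (∈-─⁺ q m v≢u)

infix 4 _◃_
data _◃_ : Fm → Fm → Set where
  ⇒◃ˡ : ∀ {A B} → A ◃ A ⇒ B
  ⇒◃ʳ : ∀ {A B} → B ◃ A ⇒ B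
  □◃  : ∀ {A} → A ◃ □ A
  △◃  : ∀ {A} → A ◃ △ A

SubformulaClosed : List Fm → Set
SubformulaClosed Fs = ∀ {C D} → D ◃ C → C ∈ Fs → D ∈ Fs

subformulas : Fm → List Fm
subformulas (A ⇒ B) = (A ⇒ B) ∷ subformulas A ++ subformulas B
subformulas (□ A)   = □ A ∷ subformulas A
subformulas (△ A)   = △ A ∷ subformulas A
subformulas A       = A ∷ []

subformulas-self : ∀ A → A ∈ subformulas A
subformulas-self ⊥ᶠ      = here refl
subformulas-self (at _)  = here refl
subformulas-self (_ ⇒ _) = here refl
subformulas-self (□ _)   = here refl
subformulas-self (△ _)   = here refl

subformulas-closed : ∀ A → SubformulaClosed (subformulas A)
subformulas-closed (A ⇒ B) ⇒◃ˡ (here refl) = there (∈-++⁺ˡ (subformulas-self A))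
subformulas-closed (A ⇒ B) ⇒◃ʳ (here refl) = there (∈-++⁺ʳ _ (subformulas-self B))
subformulas-closed (A ⇒ B) d (there m) with ∈-++⁻ (subformulas A) m
... | inj₁ mA = there (∈-++⁺ˡ (subformulas-closed A d mA))
... | inj₂ mB = there (∈-++⁺ʳ _ (subformulas-closed B d mB))
subformulas-closed (□ A) □◃ (here refl) = there (subformulas-self A)
subformulas-closed (□ A) d  (there m)   = there (subformulas-closed A d m)
subformulas-closed (△ A) △◃ (here refl) = there (subformulas-self A)
subformulas-closed (△ A) d  (there m)   = there (subformulas-closed A d m)
subformulas-closed ⊥ᶠ    () (here refl)
subformulas-closed (at _) () (here refl)

concatMap-subformulas-closed : ∀ Fs → SubformulaClosed (concatMap subformulas Fs)
concatMap-subformulas-closed Fs d m =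
  ∈-concatMap⁺ subformulas (Any.map (subformulas-closed _ d) (∈-concatMap⁻ subformulas {xs = Fs} m))

module _ {A : Set} {f g : A → ℕ} (f≤g : ∀ a → f a ≤ g a) where

  sum-map-mono : ∀ xs → sum (map f xs) ≤ sum (map g xs)
  sum-map-mono []       = z≤n
  sum-map-mono (a ∷ xs) = +-mono-≤ (f≤g a) (sum-map-mono xs)

  sum-map-strict : ∀ {xs a} → a ∈ xs → f a < g a → sum (map f xs) < sum (map g xs)
  sum-map-strict {xs = b ∷ xs} (here refl) lt = +-mono-<-≤ lt (sum-map-mono xs)
  sum-map-strict {xs = b ∷ xs} (there m)   lt = +-mono-≤-< (f≤g b) (sum-map-strict m lt)

absence : ∀ {P : Set} → Dec P → ℕ
absence (yes _) = 0
absence (no _)  = 1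

absence-≤1 : ∀ {P : Set} (p? : Dec P) → absence p? ≤ 1
absence-≤1 (yes _) = z≤n
absence-≤1 (no _)  = s≤s z≤n

module _ {P Q : Set} where

  absence-anti : (P → Q) → (p? : Dec P) (q? : Dec Q) → absence q? ≤ absence p?
  absence-anti _   _       (yes _) = z≤n
  absence-anti _   (no _)  (no _)  = ≤-refl
  absence-anti P⇒Q (yes p) (no ¬q) = contradiction (P⇒Q p) ¬q

  absence-strict : ¬ P → Q → (p? : Dec P) (q? : Dec Q) → absence q? < absence p?
  absence-strict ¬p _ (yes p) _       = contradiction p ¬p
  absence-strict _  _ (no _)  (yes _) = s≤s z≤n
  absence-strict _  q (no _)  (no ¬q) = contradiction q ¬q

mutual
  weight : (Fm → ℕ) → Fm → ℕ
  weight g C = g C + 3 * subweight g C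

  subweight : (Fm → ℕ) → Fm → ℕ
  subweight g (A ⇒ B) = weight g A + weight g B
  subweight g _       = 0

Compensated : (g′ g : Fm → ℕ) → Fm → Set
Compensated g′ g (A ⇒ B) = g′ (A ⇒ B) ≤ 2 + g (A ⇒ B) × (g′ A < g A ⊎ g′ B < g B)
Compensated g′ g _       = Empty

Dominated : (g′ g : Fm → ℕ) → Set
Dominated g′ g = ∀ C → g′ C ≤ g C ⊎ Compensated g′ g C

+-3*-absorb : ∀ {a a′ b b′} → a′ ≤ 2 + a → b′ < b → a′ + 3 * b′ < a + 3 * b
+-3*-absorb {a} {a′} {b} {b′} a′≤2+a b′<b = begin-strict
  a′ + 3 * b′       ≤⟨ ℕ.+-monoˡ-≤ (3 * b′) a′≤2+a ⟩
  2 + a + 3 * b′    <⟨ ℕ.n<1+n _ ⟩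
  3 + a + 3 * b′    ≡⟨ shift a b′ ⟩
  a + 3 * (1 + b′)  ≤⟨ ℕ.+-monoʳ-≤ a (*-monoʳ-≤ 3 b′<b) ⟩
  a + 3 * b         ∎
  where
  open ≤-Reasoning
  shift : ∀ a b → 3 + a + 3 * b ≡ a + 3 * (1 + b)
  shift = solve-∀

module _ {g′ g : Fm → ℕ} (dominated : Dominated g′ g) where

  mutual
    weight-mono : ∀ C → weight g′ C ≤ weight g C
    weight-mono C = [ weight-mono-≤ C , <⇒≤ ∘ weight-compensated C ]′ (dominated C)

    weight-strict : ∀ C → g′ C < g C ⊎ Compensated g′ g C → weight g′ C < weight g C
    weight-strict C = [ weight-mono-< C , weight-compensated C ]′

    private
      weight-mono-≤ : ∀ C → g′ C ≤ g C → weight g′ C ≤ weight g C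
      weight-mono-≤ C le = +-mono-≤ le (*-monoʳ-≤ 3 (subweight-mono C))

      weight-mono-< : ∀ C → g′ C < g C → weight g′ C < weight g C
      weight-mono-< C lt = +-mono-<-≤ lt (*-monoʳ-≤ 3 (subweight-mono C))

      weight-compensated : ∀ C → Compensated g′ g C → weight g′ C < weight g C
      weight-compensated (A ⇒ B) (grows , shrinks) = +-3*-absorb grows (subweight-strict shrinks)
        where
        subweight-strict : g′ A < g A ⊎ g′ B < g B → subweight g′ (A ⇒ B) < subweight g (A ⇒ B)
        subweight-strict (inj₁ lt) = +-mono-<-≤ (weight-strict A (inj₁ lt)) (weight-mono B)
        subweight-strict (inj₂ lt) = +-mono-≤-< (weight-mono A) (weight-strict B (inj₁ lt))

      subweight-mono : ∀ C → subweight g′ C ≤ subweight g C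
      subweight-mono (A ⇒ B) = +-mono-≤ (weight-mono A) (weight-mono B)
      subweight-mono ⊥ᶠ      = z≤n
      subweight-mono (at _)  = z≤n
      subweight-mono (□ _)   = z≤n
      subweight-mono (△ _)   = z≤n

gaps : Seq → Label → Fm → ℕ
gaps σ x C = absence ((x , C) ∈ˡ? ant σ) + absence ((x , C) ∈ˡ? suc σ)

Keeps : Seq → Seq → LFm → Set
Keeps σ σ′ v = (v ∈ ant σ → v ∈ ant σ′) × (v ∈ suc σ → v ∈ suc σ′)

Gains : Seq → Seq → LFm → Set
Gains σ σ′ v = (v ∉ ant σ × v ∈ ant σ′) ⊎ (v ∉ suc σ × v ∈ suc σ′)

gaps-≤2 : ∀ σ x C → gaps σ x C ≤ 2
gaps-≤2 σ x C = +-mono-≤ (absence-≤1 ((x , C) ∈ˡ? ant σ)) (absence-≤1 ((x , C) ∈ˡ? suc σ))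

module _ (σ σ′ : Seq) {x : Label} {C : Fm} where

  private
    ∈ᵃ? = (x , C) ∈ˡ? ant σ
    ∈ᵃ′? = (x , C) ∈ˡ? ant σ′
    ∈ˢ? = (x , C) ∈ˡ? suc σ
    ∈ˢ′? = (x , C) ∈ˡ? suc σ′

  gaps-anti : Keeps σ σ′ (x , C) → gaps σ′ x C ≤ gaps σ x C
  gaps-anti (keepsᵃ , keepsˢ) =
    +-mono-≤ (absence-anti keepsᵃ ∈ᵃ? ∈ᵃ′?) (absence-anti keepsˢ ∈ˢ? ∈ˢ′?)

  gaps-strict : Keeps σ σ′ (x , C) → Gains σ σ′ (x , C) → gaps σ′ x C < gaps σ x C
  gaps-strict (_ , keepsˢ) (inj₁ (∉ᵃ , ∈ᵃ)) =
    +-mono-<-≤ (absence-strict ∉ᵃ ∈ᵃ ∈ᵃ? ∈ᵃ′?) (absence-anti keepsˢ ∈ˢ? ∈ˢ′?)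
  gaps-strict (keepsᵃ , _) (inj₂ (∉ˢ , ∈ˢ)) =
    +-mono-≤-< (absence-anti keepsᵃ ∈ᵃ? ∈ᵃ′?) (absence-strict ∉ˢ ∈ˢ ∈ˢ? ∈ˢ′?)

_⟵ₗ_ : List Tree → List Tree → Set
ts′ ⟵ₗ ts = ts ⟶ₗ ts′

acc-∷ : ∀ {t ts} → Acc _⟵_ t → Acc _⟵ₗ_ ts → Acc _⟵ₗ_ (t ∷ ts)
acc-∷ (acc rs) (acc rss) = acc λ where
  (hd s) → acc-∷ (rs s) (acc rss)
  (tl s) → acc-∷ (acc rs) (rss s)

acc-list : ∀ {ts} → All (Acc _⟵_) ts → Acc _⟵ₗ_ ts
acc-list []       = acc λ ()
acc-list (a ∷ as) = acc-∷ a (acc-list as)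

acc-node : ∀ {σ ts} → Acc _⟵ₗ_ ts → Acc _⟵_ (node σ ts)
acc-node (acc rs) = acc λ where (inside s) → acc-node (rs s)

module Universe (Labs : List Label) (Fms : List Fm) where

  points : List LFm
  points = cartesianProduct Labs Fms

  kinds : List RK
  kinds = R ∷ S ∷ []

  atom : Label × RK → Label → RAtom
  atom (x , k) y = ⟨ x , k , y ⟩

  atoms : List RAtom
  atoms = cartesianProductWith atom (cartesianProduct Labs kinds) Labs

  atom∈atoms : ∀ {x k y} → x ∈ Labs → y ∈ Labs → ⟨ x , k , y ⟩ ∈ atoms
  atom∈atoms {k = k} x∈Labs y∈Labs =
    ∈-cartesianProductWith⁺ atom (∈-cartesianProduct⁺ x∈Labs (kind∈kinds k)) y∈Labs
    where
    kind∈kinds : ∀ k → k ∈ kinds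
    kind∈kinds R = here refl
    kind∈kinds S = there (here refl)

  record Bounded (σ : Seq) : Set where
    constructor bounded
    field
      rel-bounded : ∀ {a} → a ∈ rel σ → RAtom.src a ∈ Labs × RAtom.tgt a ∈ Labs
      ant-bounded : ant σ ⊆ points
      suc-bounded : suc σ ⊆ points

  μᶠ : Seq → ℕ
  μᶠ σ = sum (map (λ (x , C) → weight (gaps σ x) C) points)

  μʳ : List RAtom → ℕ
  μʳ ℛ = sum (map (λ a → absence (a ∈ʳ? ℛ)) atoms)

  μ : Seq → ℕ
  μ σ = μᶠ σ + μʳ (rel σ)

  μᶠ-dominated : ∀ σ σ′ {x C} → (∀ y → Dominated (gaps σ′ y) (gaps σ y)) → (x , C) ∈ points →
    gaps σ′ x C < gaps σ x C ⊎ Compensated (gaps σ′ x) (gaps σ x) C → μᶠ σ′ < μᶠ σ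
  μᶠ-dominated σ σ′ {C = C} dominated x,C∈points decrease =
    sum-map-strict (λ (y , D) → weight-mono (dominated y) D) x,C∈points
      (weight-strict (dominated _) C decrease)

  module _ {σ : Seq} {Γ′ Ω′ : List LFm} where

    private
      σ′ = rel σ ∣ Γ′ ⊢ Ω′

    μ-gain : (∀ v → Keeps σ σ′ v) → ∀ {v} → v ∈ points → Gains σ σ′ v → μ σ′ < μ σ
    μ-gain keeps v∈points gain = +-monoˡ-< (μʳ (rel σ)) (μᶠ-dominated σ σ′
      (λ y D → inj₁ (gaps-anti σ σ′ (keeps (y , D)))) v∈points
      (inj₁ (gaps-strict σ σ′ (keeps _) gain)))

    μ-replace : ∀ {x A B} → (x , A ⇒ B) ∈ points →
      (∀ v → v ≢ (x , A ⇒ B) → Keeps σ σ′ v) →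
      Gains σ σ′ (x , A) ⊎ Gains σ σ′ (x , B) → μ σ′ < μ σ
    μ-replace {x} {A} {B} p∈points keeps gain =
      +-monoˡ-< (μʳ (rel σ)) (μᶠ-dominated σ σ′ dominated p∈points (inj₂ compensated))
      where
      compensated : Compensated (gaps σ′ x) (gaps σ x) (A ⇒ B)
      compensated =
          ℕ.≤-trans (gaps-≤2 σ′ x (A ⇒ B)) (ℕ.m≤m+n 2 _)
        -- The λ () are (x , A) ≢ (x , A ⇒ B) and (x , B) ≢ (x , A ⇒ B), refuted by the occurs check.
        , Sum.map (gaps-strict σ σ′ (keeps (x , A) λ ())) (gaps-strict σ σ′ (keeps (x , B) λ ())) gain
      dominated : ∀ y → Dominated (gaps σ′ y) (gaps σ y)
      dominated y D with (y , D) ≟ˡ (x , A ⇒ B)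
      ... | yes refl = inj₂ compensated
      ... | no y,D≢p = inj₁ (gaps-anti σ σ′ (keeps (y , D) y,D≢p))

  μʳ-∷ : ∀ {a ℛ} → a ∈ atoms → a ∉ ℛ → μʳ (a ∷ ℛ) < μʳ ℛ
  μʳ-∷ {a} {ℛ} a∈atoms a∉ℛ =
    sum-map-strict (λ b → absence-anti there (b ∈ʳ? ℛ) (b ∈ʳ? (a ∷ ℛ))) a∈atoms
      (absence-strict a∉ℛ (here refl) (a ∈ʳ? ℛ) (a ∈ʳ? (a ∷ ℛ)))

  module _ (closed : SubformulaClosed Fms) where

    ◃-points : ∀ {x C D} → D ◃ C → (x , C) ∈ points → (x , D) ∈ points
    ◃-points D◃C x,C∈points =
      let x∈Labs , C∈Fms = ∈-cartesianProduct⁻ Labs Fms x,C∈points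
      in ∈-cartesianProduct⁺ x∈Labs (closed D◃C C∈Fms)

    successor-points : ∀ {σ x k y C D} → Bounded σ → ⟨ x , k , y ⟩ ∈ rel σ →
      D ◃ C → (x , C) ∈ points → (y , D) ∈ points
    successor-points b xky∈rel D◃C x,C∈points =
      ∈-cartesianProduct⁺ (proj₂ (Bounded.rel-bounded b xky∈rel))
        (proj₂ (∈-cartesianProduct⁻ Labs Fms (◃-points D◃C x,C∈points)))

    bounded-step : ∀ {σ ps} → PhaseRule σ ps → Bounded σ → All Bounded ps
    bounded-step (impL q _ _) b =
        bounded rel-bounded (ant-bounded ∘ ∈-─⁻ q)
                (∈-∷⁺ʳ (◃-points ⇒◃ˡ (ant-bounded q)) suc-bounded)
      ∷ bounded rel-bounded (∈-∷⁺ʳ (◃-points ⇒◃ʳ (ant-bounded q)) (ant-bounded ∘ ∈-─⁻ q))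
                suc-bounded
      ∷ []
      where open Bounded b
    bounded-step (impR q _) b =
        bounded rel-bounded (∈-∷⁺ʳ (◃-points ⇒◃ˡ (suc-bounded q)) ant-bounded)
                (∈-∷⁺ʳ (◃-points ⇒◃ʳ (suc-bounded q)) (suc-bounded ∘ ∈-─⁻ q))
      ∷ []
      where open Bounded b
    bounded-step (boxL r q _) b =
        bounded rel-bounded (∈-∷⁺ʳ (successor-points b r □◃ (ant-bounded q)) ant-bounded)
                suc-bounded
      ∷ []
      where open Bounded b
    bounded-step (triL r q _) b =
        bounded rel-bounded (∈-∷⁺ʳ (successor-points b r △◃ (ant-bounded q)) ant-bounded)
                suc-bounded
      ∷ []
      where open Bounded b
    bounded-step (trans _ _ r₁ r₂ _) b = bounded rel-bounded′ ant-bounded suc-bounded ∷ []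
      where
      open Bounded b
      rel-bounded′ : ∀ {a} → a ∈ _ ∷ _ → RAtom.src a ∈ Labs × RAtom.tgt a ∈ Labs
      rel-bounded′ (here refl) = proj₁ (rel-bounded r₁) , proj₂ (rel-bounded r₂)
      rel-bounded′ (there m)   = rel-bounded m

    μ-step : ∀ {σ ps} → PhaseRule σ ps → Bounded σ → All (λ σ′ → μ σ′ < μ σ) ps
    μ-step {σ} (impL q ∉ᴬ ∉ᴮ) b =
        μ-replace {σ = σ} (ant-bounded q)
          (λ _ v≢p → (λ m → ∈-─⁺ q m v≢p) , there) (inj₁ (inj₂ (∉ᴬ , here refl)))
      ∷ μ-replace {σ = σ} (ant-bounded q)
          (λ _ v≢p → (λ m → there (∈-─⁺ q m v≢p)) , id) (inj₂ (inj₁ (∉ᴮ , here refl)))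
      ∷ []
      where open Bounded b
    μ-step {σ@(ℛ ∣ Γ ⊢ Ω)} (impR {x = x} {A} {B} q ¬both) b =
        μ-replace {σ = σ} (suc-bounded q) (λ _ v≢p → there , (λ m → there (∈-─⁺ q m v≢p))) gain
      ∷ []
      where
      open Bounded b
      σ′ : Seq
      σ′ = ℛ ∣ (x , A) ∷ Γ ⊢ ((x , B) ∷ (Ω ─ q))
      gain : Gains σ σ′ (x , A) ⊎ Gains σ σ′ (x , B)
      gain with (x , A) ∈ˡ? Γ
      ... | no ∉ᴬ  = inj₁ (inj₁ (∉ᴬ , here refl))
      ... | yes ∈ᴬ = inj₂ (inj₂ ((λ ∈ᴮ → ¬both (∈ᴬ , ∈ᴮ)) , here refl))
    μ-step {σ} (boxL r q ∉ᴬ) b =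
        μ-gain {σ = σ} (λ _ → there , id)
          (successor-points b r □◃ (Bounded.ant-bounded b q)) (inj₁ (∉ᴬ , here refl))
      ∷ []
    μ-step {σ} (triL r q ∉ᴬ) b =
        μ-gain {σ = σ} (λ _ → there , id)
          (successor-points b r △◃ (Bounded.ant-bounded b q)) (inj₁ (∉ᴬ , here refl))
      ∷ []
    μ-step {σ} (trans _ _ r₁ r₂ ∉ℛ) b =
        +-monoʳ-< (μᶠ σ) (μʳ-∷ (atom∈atoms (proj₁ (rel-bounded r₁)) (proj₂ (rel-bounded r₂))) ∉ℛ)
      ∷ []
      where open Bounded b

    acc-leaf : ∀ {σ} → Bounded σ → Acc _<_ (μ σ) → Acc _⟵_ (leaf σ)
    acc-leaf b (acc rs) = acc λ where
      (expand r) → acc-node (acc-list (All.map⁺ (All.zipWith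
        (λ (b′ , μ′<μ) → acc-leaf b′ (rs μ′<μ)) (bounded-step r b , μ-step r b))))

labels : Seq → List Label
labels σ = map RAtom.src (rel σ) ++ map RAtom.tgt (rel σ) ++ map proj₁ (ant σ ++ suc σ)

formulas : Seq → List Fm
formulas σ = concatMap subformulas (map proj₂ (ant σ ++ suc σ))

bounded-self : ∀ σ → Universe.Bounded (labels σ) (formulas σ) σ
bounded-self (ℛ ∣ Γ ⊢ Ω) =
  Universe.bounded rel-bounded (in-scope ∘ ∈-++⁺ˡ) (in-scope ∘ ∈-++⁺ʳ Γ)
  where
  rel-bounded : ∀ {a} → a ∈ ℛ → RAtom.src a ∈ labels (ℛ ∣ Γ ⊢ Ω) × RAtom.tgt a ∈ labels (ℛ ∣ Γ ⊢ Ω)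
  rel-bounded a∈ℛ =
    ∈-++⁺ˡ (∈-map⁺ RAtom.src a∈ℛ) , ∈-++⁺ʳ (map RAtom.src ℛ) (∈-++⁺ˡ (∈-map⁺ RAtom.tgt a∈ℛ))
  in-scope : Γ ++ Ω ⊆ Universe.points (labels (ℛ ∣ Γ ⊢ Ω)) (formulas (ℛ ∣ Γ ⊢ Ω))
  in-scope {x , C} v∈ = ∈-cartesianProduct⁺
    (∈-++⁺ʳ (map RAtom.src ℛ) (∈-++⁺ʳ (map RAtom.tgt ℛ) (∈-map⁺ proj₁ v∈)))
    (∈-concatMap⁺ subformulas {xs = map proj₂ (Γ ++ Ω)}
      (Any.map (λ { refl → subformulas-self C }) (∈-map⁺ proj₂ v∈)))

acc-leaf : ∀ σ → Acc _⟵_ (leaf σ)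
acc-leaf σ = Universe.acc-leaf (labels σ) (formulas σ)
  (concatMap-subformulas-closed (map proj₂ (ant σ ++ suc σ))) (bounded-self σ) (<-wellFounded _)

mutual
  acc-tree : ∀ T → Acc _⟵_ T
  acc-tree (leaf σ)    = acc-leaf σ
  acc-tree (node _ ts) = acc-node (acc-list (acc-trees ts))

  acc-trees : ∀ ts → All (Acc _⟵_) ts
  acc-trees []       = []
  acc-trees (t ∷ ts) = acc-tree t ∷ acc-trees ts

mutual
  step-at-leaf : ∀ {σ T ps} → OpenLeaf σ T → PhaseRule σ ps → ∃ (T ⟶_)
  step-at-leaf here       r = _ , expand r
  step-at-leaf (below ls) r = let _ , s = step-at-some-leaf ls r in _ , inside s

  step-at-some-leaf : ∀ {σ ts ps} → Any (OpenLeaf σ) ts → PhaseRule σ ps → ∃ (ts ⟶ₗ_)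
  step-at-some-leaf (here l)   r = let _ , s = step-at-leaf l r in _ , hd s
  step-at-some-leaf (there ls) r = let _ , s = step-at-some-leaf ls r in _ , tl s

saturated-if-stuck : ∀ {σ} → (∀ {ps} → ¬ PhaseRule σ ps) → Saturated σ
saturated-if-stuck {ℛ ∣ Γ ⊢ Ω} stuck = All.tabulate sat-ant , All.tabulate sat-suc , trans-closed
  where
  sat-ant : ∀ {v} → v ∈ Γ → SatAnt (ℛ ∣ Γ ⊢ Ω) v
  sat-ant {x , ⊥ᶠ}   _ = tt
  sat-ant {x , at _} _ = tt
  sat-ant {x , A ⇒ B} q with (x , A) ∈ˡ? Ω | (x , B) ∈ˡ? Γ
  ... | yes ∈ᴬ | _      = inj₁ ∈ᴬ
  ... | no _   | yes ∈ᴮ = inj₂ ∈ᴮ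
  ... | no ∉ᴬ  | no ∉ᴮ  = contradiction (impL q ∉ᴬ ∉ᴮ) stuck
  sat-ant {x , □ A} q y r with (y , A) ∈ˡ? Γ
  ... | yes ∈ᴬ = ∈ᴬ
  ... | no ∉ᴬ  = contradiction (boxL r q ∉ᴬ) stuck
  sat-ant {x , △ A} q y r with (y , A) ∈ˡ? Γ
  ... | yes ∈ᴬ = ∈ᴬ
  ... | no ∉ᴬ  = contradiction (triL r q ∉ᴬ) stuck
  sat-suc : ∀ {v} → v ∈ Ω → SatSuc (ℛ ∣ Γ ⊢ Ω) v
  sat-suc {x , ⊥ᶠ}   _ = tt
  sat-suc {x , at _} _ = tt
  sat-suc {x , □ _}  _ = tt
  sat-suc {x , △ _}  _ = tt
  sat-suc {x , A ⇒ B} q with (x , A) ∈ˡ? Γ ×-dec (x , B) ∈ˡ? Ω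
  ... | yes both = both
  ... | no ¬both = contradiction (impR q ¬both) stuck
  trans-closed : TransClosed (ℛ ∣ Γ ⊢ Ω)
  trans-closed x y z k k′ r₁ r₂ with ⟨ x , k′ , z ⟩ ∈ʳ? ℛ
  ... | yes ∈ℛ = ∈ℛ
  ... | no ∉ℛ  = contradiction (trans k k′ r₁ r₂ ∉ℛ) stuck

lemma2 : (Other : Seq → List Seq → Set) (T : Tree) → IsDerivation Other T →
    Acc _⟵_ T ×
    (∀ T′ → Star _⟶_ T T′ → (∀ T″ → ¬ (T′ ⟶ T″)) →
    ∀ σ → OpenLeaf σ T′ → Saturated σ)
lemma2 Other T _ =
  acc-tree T , λ _ _ stuck _ leaf → saturated-if-stuck (λ r → uncurry stuck (step-at-leaf leaf r))
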